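{- If $\models_{\mathbf{A}} S$ for a labelled sequent $S$, then $S$ is derivable in $\mathbf{GA_l}$.
   Context: Formulas are built from propositional variables and $t$ using $+,\to,\Rightarrow$ (binary) and $\lnot$; under a valuation $v$ into $\mathbb{Q}$: $v(t)=0$, $v(A+B)=v(A)+v(B)$, $v(\lnot A)=-v(A)$, $v(A\to B)=v(B)-v(A)$, $v(A\Rightarrow B)=\min(0,v(B)-v(A))$ (i.e. $A\Rightarrow B=(A\to B)\land t$). Labels are generated from the unit label $1$ and atomic labels $x_1,x_2,\ldots$ by concatenation $xy$. A labelled formula is $x:A$ with $x$ a label; a labelled sequent $\Gamma\vdash\Delta$ is a pair of finite multisets of labelled formulas. A labelling function $f$ maps labels to $\{0,1\}$ with $f(1)=1$ and $f(xy)=f(x)f(y)$; $f(\Gamma)$ is the multiset $\{A : x:A\in\Gamma, f(x)=1\}$. $\models_{\mathbf{A}}\Gamma\vdash\Delta$ means: for every valuation $v$ into $\mathbb{Q}$ there is a labelling function $f$ with $\sum_{A\in f(\Gamma)}v(A)\le\sum_{B\in f(\Delta)}v(B)$. Calculus $\mathbf{GA_l}$ (premise(s) / conclusion): $(t,l)$ $\Gamma\vdash\Delta/\Gamma,x:t\vdash\Delta$; $(t,r)$ $\Gamma\vdash\Delta/\Gamma\vdash x:t,\Delta$; $(\lnot,l)$ $\Gamma\vdash x:A,\Delta/\Gamma,x:\lnot A\vdash\Delta$; $(\lnot,r)$ $\Gamma,x:A\vdash\Delta/\Gamma\vdash x:\lnot A,\Delta$; $(+,l)$ $\Gamma,x:A,x:B\vdash\Delta/\Gamma,x:A+B\vdash\Delta$;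 $(+,r)$ $\Gamma\vdash\Delta,x:A,x:B/\Gamma\vdash\Delta,x:A+B$; $(\to,l)$ $\Gamma,x:B\vdash\Delta,x:A/\Gamma,x:A\to B\vdash\Delta$; $(\to,r)$ $\Gamma,x:A\vdash\Delta,x:B/\Gamma\vdash\Delta,x:A\to B$; $(\Rightarrow,l)$ $\Gamma,xy:B\vdash\Delta,xy:A/\Gamma,x:A\Rightarrow B\vdash\Delta$ where $y$ is an atomic label not occurring in the conclusion; $(\Rightarrow,r)$ two premises $\Gamma,x:A\vdash\Delta,x:B$ and $\Gamma\vdash\Delta$, conclusion $\Gamma\vdash\Delta,x:A\Rightarrow B$; (success) axiom $\Gamma\vdash\Delta$ whenever all formulas in $\Gamma,\Delta$ are propositional variables and there exist labelling functions $f_1,\ldots,f_n$ ($n\ge1$) with $\biguplus_{i=1}^n f_i(\Gamma)=\biguplus_{i=1}^n f_i(\Delta)$. -}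

module Defs where

open import Data.Nat using (ℕ)
open import Data.Bool using (Bool; true; false; _∧_)
open import Data.List using (List; []; _∷_; concatMap; map; filter; foldr)
open import Data.List.Relation.Binary.Permutation.Propositional using (_↭_)
open import Data.List.Relation.Unary.All using (All)
open import Data.Product using (_×_; _,_; proj₁; proj₂; Σ; ∃)
open import Data.Rational using (ℚ; 0ℚ; _+_; -_; _-_; _⊓_; _≤_)
open import Relation.Binary.PropositionalEquality using (_≡_; _≢_)
open import Relation.Nullary using (¬_)
open import Relation.Nullary.Decidable using (Dec; yes; no)

infixr 6 _⊕_
infixr 5 _⟶_ _⟹_

data Fm : Set where
  var  : ℕ → Fm
  t    : Fm
  _⊕_  : Fm → Fm → Fm
  ¬'   : Fm → Fm
  _⟶_ : Fm → Fm → Fm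
  _⟹_ : Fm → Fm → Fm

⟦_⟧ : Fm → (ℕ → ℚ) → ℚ
⟦ var p ⟧ v = v p
⟦ t ⟧ v = 0ℚ
⟦ A ⊕ B ⟧ v = ⟦ A ⟧ v + ⟦ B ⟧ v
⟦ ¬' A ⟧ v = - ⟦ A ⟧ v
⟦ A ⟶ B ⟧ v = ⟦ B ⟧ v - ⟦ A ⟧ v
⟦ A ⟹ B ⟧ v = 0ℚ ⊓ (⟦ B ⟧ v - ⟦ A ⟧ v)

data Label : Set where
  one  : Label
  atom : ℕ → Label
  _·_  : Label → Label → Label

data Occurs (i : ℕ) : Label → Set where
  here : Occurs i (atom i)
  left  : ∀ {x y} → Occurs i x → Occurs i (x · y)
  right : ∀ {x y} → Occurs i y → Occurs i (x · y)

-- Labelled formulas and sequents (multisets represented as lists, taken up to permutation)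
LFm : Set
LFm = Label × Fm

infix 4 _∶_
_∶_ : Label → Fm → LFm
x ∶ A = x , A

OccursIn : ℕ → List LFm → Set
OccursIn i Γ = Data.List.Relation.Unary.Any.Any (λ xA → Occurs i (proj₁ xA)) Γ
  where import Data.List.Relation.Unary.Any

-- A labelling function is determined by its values on atomic labels
LabFun : Set
LabFun = ℕ → Bool

applyLab : LabFun → Label → Bool
applyLab f one = true
applyLab f (atom i) = f i
applyLab f (x · y) = applyLab f x ∧ applyLab f y

select : LabFun → List LFm → List Fm
select f [] = []
select f ((x , A) ∷ Γ) with applyLab f x
... | true  = A ∷ select f Γ
... | false = select f Γ

sumV : (ℕ → ℚ) → List Fm → ℚ
sumV v = foldr (λ A s → ⟦ A ⟧ v + s) 0ℚ

Valid : List LFm → List LFm → Set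
Valid Γ Δ = ∀ (v : ℕ → ℚ) → ∃ λ (f : LabFun) → sumV v (select f Γ) ≤ sumV v (select f Δ)

IsVar : Fm → Set
IsVar (var _) = ⊤' where open import Data.Unit using () renaming (⊤ to ⊤')
IsVar _ = ⊥' where open import Data.Empty using () renaming (⊥ to ⊥')

selectAll : List LabFun → List LFm → List Fm
selectAll fs Γ = concatMap (λ f → select f Γ) fs

infix 3 _⊢_

-- Derivability in GA_l. Principal formulas are at the head of the lists;
-- the rule `perm` makes sequents multisets.
data _⊢_ : List LFm → List LFm → Set where
  perm    : ∀ {Γ Γ' Δ Δ'} → Γ ↭ Γ' → Δ ↭ Δ' → Γ ⊢ Δ → Γ' ⊢ Δ'
  success : ∀ {Γ Δ} → All (λ xA → IsVar (proj₂ xA)) Γ → All (λ xA → IsVar (proj₂ xA)) Δ →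
            (fs : List LabFun) → fs ≢ [] → selectAll fs Γ ↭ selectAll fs Δ → Γ ⊢ Δ
  t-l     : ∀ {Γ Δ x} → Γ ⊢ Δ → (x ∶ t) ∷ Γ ⊢ Δ
  t-r     : ∀ {Γ Δ x} → Γ ⊢ Δ → Γ ⊢ (x ∶ t) ∷ Δ
  ¬-l     : ∀ {Γ Δ x A} → Γ ⊢ (x ∶ A) ∷ Δ → (x ∶ ¬' A) ∷ Γ ⊢ Δ
  ¬-r     : ∀ {Γ Δ x A} → (x ∶ A) ∷ Γ ⊢ Δ → Γ ⊢ (x ∶ ¬' A) ∷ Δ
  ⊕-l     : ∀ {Γ Δ x A B} → (x ∶ A) ∷ (x ∶ B) ∷ Γ ⊢ Δ → (x ∶ A ⊕ B) ∷ Γ ⊢ Δ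
  ⊕-r     : ∀ {Γ Δ x A B} → Γ ⊢ (x ∶ A) ∷ (x ∶ B) ∷ Δ → Γ ⊢ (x ∶ A ⊕ B) ∷ Δ
  ⟶-l    : ∀ {Γ Δ x A B} → (x ∶ B) ∷ Γ ⊢ (x ∶ A) ∷ Δ → (x ∶ A ⟶ B) ∷ Γ ⊢ Δ
  ⟶-r    : ∀ {Γ Δ x A B} → (x ∶ A) ∷ Γ ⊢ (x ∶ B) ∷ Δ → Γ ⊢ (x ∶ A ⟶ B) ∷ Δ
  ⟹-l    : ∀ {Γ Δ x A B} (i : ℕ) →
            ¬ OccursIn i ((x ∶ A ⟹ B) ∷ Γ) → ¬ OccursIn i Δ →
            (x · atom i ∶ B) ∷ Γ ⊢ (x · atom i ∶ A) ∷ Δ → (x ∶ A ⟹ B) ∷ Γ ⊢ Δ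
  ⟹-r    : ∀ {Γ Δ x A B} → (x ∶ A) ∷ Γ ⊢ (x ∶ B) ∷ Δ → Γ ⊢ Δ → Γ ⊢ (x ∶ A ⟹ B) ∷ Δ

module Submission where

-- Every rule of GA_l transfers ⊨_A from its conclusion to its premises (for ⇒-left the fresh atom
-- is labelled true exactly when v(B) ≤ v(A), so that the premise contributes min(0, v(B) − v(A))
-- where the conclusion did). Decomposing a valid sequent therefore reduces the theorem to atomic
-- sequents, the total size of the formulas decreasing at each step.
--
-- For an atomic sequent Γ ⊢ Δ, a list fs of labelling functions has the excess
-- Σ_{f ∈ fs} (Σ v(f(Γ)) − Σ v(f(Δ))), an affine function of each variable. Validity says that the
-- singletons [f] cover every valuation v: one of them has excess ≤ 0 at v. Fourier–Motzkin
-- elimination removes the variables one at a time, replacing the lists whose coefficient of p is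
-- nonzero by positive integer combinations of pairs with opposite coefficients. Covering survives:
-- otherwise, along the line v[p ≔ τ], the old lists would all have positive excess for some common
-- τ. Once every variable is eliminated, a covering list has all coefficients zero, which says that
-- ⊎ f(Γ) and ⊎ f(Δ) are the same multiset: the success axiom.

open import Data.Bool using (Bool; true; false; _∧_; if_then_else_)
open import Data.Empty using (⊥; ⊥-elim)
open import Data.List using (List; []; _∷_; _++_; [_]; map; mapMaybe; filter; foldr; length; cartesianProductWith)
open import Data.List.Membership.Propositional using (_∈_; _∉_; find; lose)
open import Data.List.Membership.Propositional.Properties
  using (∈-map⁺; ∈-map⁻; ∈-++⁺ˡ; ∈-++⁺ʳ; ∈-++⁻; ∈-∃++; ∈-filter⁺; ∈-filter⁻;
         ∈-cartesianProductWith⁺; ∈-cartesianProductWith⁻)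
open import Data.List.Properties using (filter-++; filter-accept; filter-reject; filter-none; length-++)
open import Data.List.Relation.Binary.Permutation.Propositional as ↭
  using (_↭_; prep; swap; ↭-sym; ↭-trans; ↭-refl)
open import Data.List.Relation.Binary.Permutation.Propositional.Properties
  using (↭-length; filter-↭; mapMaybe-↭; shift; map⁺; All-resp-↭)
open import Data.List.Relation.Unary.All as All using (All; []; _∷_; all?)
import Data.List.Relation.Unary.All.Properties as Allₚ
open import Data.List.Relation.Unary.Any using (here; there; any?)
open import Data.List.Relation.Unary.Any.Properties using (++⁺ˡ; ++⁺ʳ)
open import Data.Maybe using (Maybe; just; nothing)
open import Data.Nat as ℕ using (ℕ; zero; suc; _∸_; s≤s)
open import Data.Nat.ListAction using (sum)
open import Data.Nat.ListAction.Properties using (sum-↭)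
import Data.Nat.Properties as ℕₚ
open import Data.Nat.Tactic.RingSolver using (solve-∀)
open import Data.List.Membership.DecPropositional ℕₚ._≟_ using (_∈?_)
open import Data.Product using (_×_; _,_; ∃-syntax; proj₂; uncurry)
open import Data.Rational
  using (ℚ; 0ℚ; 1ℚ; _+_; _*_; -_; _-_; _÷_; 1/_; _≤_; _<_; _⊓_; _⊔_;
         ≢-nonZero; nonNegative; nonPositive; positive; negative)
import Data.Rational.Properties as ℚₚ
open import Algebra.Properties.Group ℚₚ.+-0-group using (x∙y⁻¹≈ε⇒x≈y)
open import Data.Rational.Solver using (module +-*-Solver)
open import Data.Sum using (_⊎_; inj₁; inj₂)
open import Function using (_∘_)
open import Relation.Binary.Definitions using (Tri; tri<; tri≈; tri>)
open import Relation.Binary.PropositionalEquality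
  using (_≡_; _≢_; refl; sym; trans; cong; cong₂; subst; subst₂; ≢-sym; module ≡-Reasoning)
open import Relation.Nullary using (Dec; yes; no; ¬_; contradiction)
open import Relation.Nullary.Decidable using (map′)

open import Defs

open +-*-Solver using (solve; _:+_; _:*_; _:-_; :-_; con; _:=_)
open Allₚ using (¬Any⇒All¬; ¬All⇒Any¬)

p+[q-p]≡q : ∀ p q → p + (q - p) ≡ q
p+[q-p]≡q = solve 2 (λ p q → p :+ (q :- p) := q) refl

p+0*q≡p : ∀ p q → p + 0ℚ * q ≡ p
p+0*q≡p = solve 2 (λ p q → p :+ con 0ℚ :* q := p) refl

0<q-p⇒p<q : ∀ {p q} → 0ℚ < q - p → p < q
0<q-p⇒p<q {p} {q} 0<q-p = subst₂ _<_ (ℚₚ.+-identityʳ p) (p+[q-p]≡q p q) (ℚₚ.+-monoʳ-< p 0<q-p)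

0≤q-p⇒p≤q : ∀ {p q} → 0ℚ ≤ q - p → p ≤ q
0≤q-p⇒p≤q {p} {q} 0≤q-p = subst₂ _≤_ (ℚₚ.+-identityʳ p) (p+[q-p]≡q p q) (ℚₚ.+-monoʳ-≤ p 0≤q-p)

p-q≤0⇒p≤q : ∀ {p q} → p - q ≤ 0ℚ → p ≤ q
p-q≤0⇒p≤q {p} {q} p-q≤0 = subst₂ _≤_ ([p-q]+q≡p p q) (ℚₚ.+-identityˡ q) (ℚₚ.+-monoˡ-≤ q p-q≤0)
  where [p-q]+q≡p : ∀ p q → (p - q) + q ≡ p
        [p-q]+q≡p = solve 2 (λ p q → (p :- q) :+ q := p) refl

p≤q⇒p-q≤0 : ∀ {p q} → p ≤ q → p - q ≤ 0ℚ
p≤q⇒p-q≤0 {p} {q} p≤q = subst (p - q ≤_) (ℚₚ.+-inverseʳ q) (ℚₚ.+-monoˡ-≤ (- q) p≤q)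

p-1<p : ∀ p → p - 1ℚ < p
p-1<p p = 0<q-p⇒p<q (subst (0ℚ <_) (1≡p-[p-1] p) (ℚₚ.positive⁻¹ 1ℚ))
  where 1≡p-[p-1] : ∀ p → 1ℚ ≡ p - (p - 1ℚ)
        1≡p-[p-1] = solve 1 (λ p → con 1ℚ := p :- (p :- con 1ℚ)) refl

p<p+1 : ∀ p → p < p + 1ℚ
p<p+1 p = 0<q-p⇒p<q (subst (0ℚ <_) (1≡[p+1]-p p) (ℚₚ.positive⁻¹ 1ℚ))
  where 1≡[p+1]-p : ∀ p → 1ℚ ≡ (p + 1ℚ) - p
        1≡[p+1]-p = solve 1 (λ p → con 1ℚ := (p :+ con 1ℚ) :- p) refl

<-⊓ : ∀ {p q r} → p < q → p < r → p < q ⊓ r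
<-⊓ {p} {q} {r} p<q p<r with ℚₚ.⊓-sel q r
... | inj₁ q⊓r≡q = subst (p <_) (sym q⊓r≡q) p<q
... | inj₂ q⊓r≡r = subst (p <_) (sym q⊓r≡r) p<r

⊔-< : ∀ {p q r} → p < r → q < r → p ⊔ q < r
⊔-< {p} {q} {r} p<r q<r with ℚₚ.⊔-sel p q
... | inj₁ p⊔q≡p = subst (_< r) (sym p⊔q≡p) p<r
... | inj₂ p⊔q≡q = subst (_< r) (sym p⊔q≡q) q<r

≤-replace : ∀ {a b a′ b′ g d} → a′ - b′ ≤ a - b → a + g ≤ b + d → a′ + g ≤ b′ + d
≤-replace {a} {b} {a′} {b′} {g} {d} a′-b′≤a-b a+g≤b+d = p-q≤0⇒p≤q (begin
  (a′ + g) - (b′ + d)   ≡⟨ regroup a′ b′ g d ⟩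
  (a′ - b′) + (g - d)   ≤⟨ ℚₚ.+-monoˡ-≤ (g - d) a′-b′≤a-b ⟩
  (a - b) + (g - d)     ≡⟨ regroup a b g d ⟨
  (a + g) - (b + d)     ≤⟨ p≤q⇒p-q≤0 a+g≤b+d ⟩
  0ℚ                    ∎)
  where
  open ℚₚ.≤-Reasoning
  regroup : ∀ a b g d → (a + g) - (b + d) ≡ (a - b) + (g - d)
  regroup = solve 4 (λ a b g d → (a :+ g) :- (b :+ d) := (a :- b) :+ (g :- d)) refl

fromℕ : ℕ → ℚ
fromℕ zero = 0ℚ
fromℕ (suc n) = 1ℚ + fromℕ n

fromℕ-+ : ∀ m n → fromℕ (m ℕ.+ n) ≡ fromℕ m + fromℕ n
fromℕ-+ zero n = sym (ℚₚ.+-identityˡ (fromℕ n))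
fromℕ-+ (suc m) n = trans (cong (1ℚ +_) (fromℕ-+ m n)) (sym (ℚₚ.+-assoc 1ℚ (fromℕ m) (fromℕ n)))

fromℕ-nonNeg : ∀ n → 0ℚ ≤ fromℕ n
fromℕ-nonNeg zero = ℚₚ.≤-refl
fromℕ-nonNeg (suc n) = ℚₚ.+-mono-≤ (ℚₚ.nonNegative⁻¹ 1ℚ) (fromℕ-nonNeg n)

fromℕ-mono-< : ∀ {m n} → m ℕ.< n → fromℕ m < fromℕ n
fromℕ-mono-< {zero} {suc n} _ = ℚₚ.+-mono-<-≤ (ℚₚ.positive⁻¹ 1ℚ) (fromℕ-nonNeg n)
fromℕ-mono-< {suc m} {suc n} (s≤s m<n) = ℚₚ.+-monoʳ-< 1ℚ (fromℕ-mono-< m<n)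

fromℕ-cancel-≤ : ∀ {m n} → fromℕ m ≤ fromℕ n → m ℕ.≤ n
fromℕ-cancel-≤ {m} {n} m≤n with ℕₚ.≤-<-connex m n
... | inj₁ m≤n′ = m≤n′
... | inj₂ n<m = contradiction (ℚₚ.<-≤-trans (fromℕ-mono-< n<m) m≤n) (ℚₚ.<-irrefl refl)

fromℕ-∸ : ∀ {m n} → n ℕ.≤ m → fromℕ (m ∸ n) ≡ fromℕ m - fromℕ n
fromℕ-∸ {m} {n} n≤m = begin
  fromℕ (m ∸ n)                         ≡⟨ p≡[q+p]-q (fromℕ (m ∸ n)) (fromℕ n) ⟩
  (fromℕ n + fromℕ (m ∸ n)) - fromℕ n   ≡⟨ cong (_- fromℕ n) (fromℕ-+ n (m ∸ n)) ⟨
  fromℕ (n ℕ.+ (m ∸ n)) - fromℕ n       ≡⟨ cong (λ k → fromℕ k - fromℕ n) (ℕₚ.m+[n∸m]≡n n≤m) ⟩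
  fromℕ m - fromℕ n                     ∎
  where
  open ≡-Reasoning
  p≡[q+p]-q : ∀ p q → p ≡ (q + p) - q
  p≡[q+p]-q = solve 2 (λ p q → p := (q :+ p) :- q) refl

fromℕ-sub-injective : ∀ {m n} → fromℕ m - fromℕ n ≡ 0ℚ → m ≡ n
fromℕ-sub-injective {m} {n} eq =
  ℕₚ.≤-antisym (fromℕ-cancel-≤ (ℚₚ.≤-reflexive fm≡fn)) (fromℕ-cancel-≤ (ℚₚ.≤-reflexive (sym fm≡fn)))
  where fm≡fn = x∙y⁻¹≈ε⇒x≈y (fromℕ m) (fromℕ n) eq

-- Strict affine inequalities in one unknown

-- The value at a = 0 is junk.
root : ℚ → ℚ → ℚ
root a b with a ℚₚ.≟ 0ℚ
... | yes _ = 0ℚ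
... | no a≢0 = _÷_ (- b) a {{≢-nonZero a≢0}}

b+a*root≡0 : ∀ a b → a ≢ 0ℚ → b + a * root a b ≡ 0ℚ
b+a*root≡0 a b a≢0 with a ℚₚ.≟ 0ℚ
... | yes a≡0 = contradiction a≡0 a≢0
... | no a≢0′ = begin
  b + a * (- b * 1/a)   ≡⟨ cong (b +_) (exchange a b 1/a) ⟩
  b + - b * (a * 1/a)   ≡⟨ cong (λ x → b + - b * x) (ℚₚ.*-inverseʳ a {{nonZero}}) ⟩
  b + - b * 1ℚ          ≡⟨ b-b≡0 b ⟩
  0ℚ                    ∎
  where
  open ≡-Reasoning
  nonZero = ≢-nonZero a≢0′
  1/a = 1/_ a {{nonZero}}
  exchange : ∀ a b c → a * (- b * c) ≡ - b * (a * c)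
  exchange = solve 3 (λ a b c → a :* (:- b :* c) := :- b :* (a :* c)) refl
  b-b≡0 : ∀ b → b + - b * 1ℚ ≡ 0ℚ
  b-b≡0 = solve 1 (λ b → b :+ :- b :* con 1ℚ := con 0ℚ) refl

a*root<a*τ⇒0<b+a*τ : ∀ a b τ → a ≢ 0ℚ → a * root a b < a * τ → 0ℚ < b + a * τ
a*root<a*τ⇒0<b+a*τ a b τ a≢0 lt = subst (_< b + a * τ) (b+a*root≡0 a b a≢0) (ℚₚ.+-monoʳ-< b lt)

root<root : ∀ {a b c d} → 0ℚ < a → c < 0ℚ → 0ℚ < (- c) * b + a * d → root a b < root c d
root<root {a} {b} {c} {d} 0<a c<0 0<e =
  ℚₚ.*-cancelˡ-<-nonPos (a * c) {{ac≤0}} (0<q-p⇒p<q (subst (0ℚ <_) e≡ 0<e))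
  where
  ac≤0 = ℚₚ.nonNeg*nonPos⇒nonPos a {{nonNegative (ℚₚ.<⇒≤ 0<a)}} c {{nonPositive (ℚₚ.<⇒≤ c<0)}}
  r₁ = root a b
  r₂ = root c d
  expand : ∀ a b c d r₁ r₂ →
    (- c) * b + a * d ≡ (a * c * r₁ - a * c * r₂) + ((- c) * (b + a * r₁) + a * (d + c * r₂))
  expand = solve 6 (λ a b c d r₁ r₂ → (:- c) :* b :+ a :* d
                      := (a :* c :* r₁ :- a :* c :* r₂) :+ ((:- c) :* (b :+ a :* r₁) :+ a :* (d :+ c :* r₂))) refl
  x+0≡x : ∀ a c x → x + ((- c) * 0ℚ + a * 0ℚ) ≡ x
  x+0≡x = solve 3 (λ a c x → x :+ ((:- c) :* con 0ℚ :+ a :* con 0ℚ) := x) refl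
  e≡ : (- c) * b + a * d ≡ a * c * r₁ - a * c * r₂
  e≡ = begin
    (- c) * b + a * d   ≡⟨ expand a b c d r₁ r₂ ⟩
    _                   ≡⟨ cong₂ (λ x y → (a * c * r₁ - a * c * r₂) + ((- c) * x + a * y))
                            (b+a*root≡0 a b (λ a≡0 → ℚₚ.<-irrefl (sym a≡0) 0<a))
                            (b+a*root≡0 c d (λ c≡0 → ℚₚ.<-irrefl c≡0 c<0)) ⟩
    _                   ≡⟨ x+0≡x a c _ ⟩
    a * c * r₁ - a * c * r₂ ∎
    where open ≡-Reasoning

below-all : (us : List ℚ) → ∃[ τ ] All (τ <_) us
below-all [] = 0ℚ , []
below-all (u ∷ us) with below-all us
... | τ , τ<us = τ ⊓ (u - 1ℚ) ,
  ℚₚ.≤-<-trans (ℚₚ.p⊓q≤q τ _) (p-1<p u) ∷ All.map (ℚₚ.≤-<-trans (ℚₚ.p⊓q≤p τ _)) τ<us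

between : ∀ l us → All (l <_) us → ∃[ m ] l < m × All (m <_) us
between l [] [] = l + 1ℚ , p<p+1 l , []
between l (u ∷ us) (l<u ∷ l<us) with between l us l<us | ℚₚ.<-dense l<u
... | m , l<m , m<us | r , l<r , r<u = m ⊓ r , <-⊓ l<m l<r ,
  ℚₚ.≤-<-trans (ℚₚ.p⊓q≤q m r) r<u ∷ All.map (ℚₚ.≤-<-trans (ℚₚ.p⊓q≤p m r)) m<us

interpolate : ∀ ls us → All (λ l → All (l <_) us) ls → ∃[ τ ] All (_< τ) ls × All (τ <_) us
interpolate [] us [] = let τ , τ<us = below-all us in τ , [] , τ<us
interpolate (l ∷ ls) us (l<us ∷ ls<us) with interpolate ls us ls<us | between l us l<us
... | τ , ls<τ , τ<us | m , l<m , m<us = τ ⊔ m ,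
  (ℚₚ.<-≤-trans l<m (ℚₚ.p≤q⊔p τ m) ∷ All.map (λ x<τ → ℚₚ.<-≤-trans x<τ (ℚₚ.p≤p⊔q τ m)) ls<τ) ,
  All.zipWith (uncurry ⊔-<) (τ<us , m<us)

-- The constraints with a c > 0 ask for τ above root (a c) (b c), those with a c < 0 for τ below it;
-- the second hypothesis says that every such lower bound lies below every such upper bound.
strictAffineSystem-solvable : {C : Set} (a b : C → ℚ) (cs : List C) →
  (∀ {c} → c ∈ cs → a c ≡ 0ℚ → 0ℚ < b c) →
  (∀ {c d} → c ∈ cs → d ∈ cs → 0ℚ < a c → a d < 0ℚ → 0ℚ < (- a d) * b c + a c * b d) →
  ∃[ τ ] (∀ {c} → c ∈ cs → 0ℚ < b c + a c * τ)
strictAffineSystem-solvable {C} a b cs flat-ok opposite-ok = solution (interpolate _ _ separated)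
  where
  r : C → ℚ
  r c = root (a c) (b c)
  rising falling : List C
  rising  = filter (λ c → 0ℚ ℚₚ.<? a c) cs
  falling = filter (λ c → a c ℚₚ.<? 0ℚ) cs

  separated : All (λ l → All (l <_) (map r falling)) (map r rising)
  separated = All.tabulate λ l∈ → All.tabulate λ u∈ → r<r (∈-map⁻ r l∈) (∈-map⁻ r u∈)
    where
    r<r : ∀ {l u} → ∃[ c ] c ∈ rising × l ≡ r c → ∃[ d ] d ∈ falling × u ≡ r d → l < u
    r<r (c , c∈ , refl) (d , d∈ , refl) with ∈-filter⁻ _ c∈ | ∈-filter⁻ _ d∈
    ... | c∈cs , 0<ac | d∈cs , ad<0 = root<root 0<ac ad<0 (opposite-ok c∈cs d∈cs 0<ac ad<0)

  solution : ∃[ τ ] All (_< τ) (map r rising) × All (τ <_) (map r falling) →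
             ∃[ τ ] (∀ {c} → c ∈ cs → 0ℚ < b c + a c * τ)
  solution (τ , rising<τ , τ<falling) = τ , λ {c} c∈ → satisfied c∈ (ℚₚ.<-cmp (a c) 0ℚ)
    where
    satisfied : ∀ {c} → c ∈ cs → Tri (a c < 0ℚ) (a c ≡ 0ℚ) (0ℚ < a c) → 0ℚ < b c + a c * τ
    satisfied {c} c∈ (tri< ac<0 _ _) = a*root<a*τ⇒0<b+a*τ (a c) (b c) τ (ℚₚ.<⇒≢ ac<0)
      (ℚₚ.*-monoʳ-<-neg (a c) {{negative ac<0}} (All.lookup τ<falling (∈-map⁺ r (∈-filter⁺ _ c∈ ac<0))))
    satisfied {c} c∈ (tri≈ _ ac≡0 _) =
      subst (0ℚ <_) (sym (trans (cong (λ x → b c + x * τ) ac≡0) (p+0*q≡p (b c) τ))) (flat-ok c∈ ac≡0)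
    satisfied {c} c∈ (tri> _ _ 0<ac) = a*root<a*τ⇒0<b+a*τ (a c) (b c) τ (≢-sym (ℚₚ.<⇒≢ 0<ac))
      (ℚₚ.*-monoʳ-<-pos (a c) {{positive 0<ac}} (All.lookup rising<τ (∈-map⁺ r (∈-filter⁺ _ c∈ 0<ac))))

module _ {A : Set} where

  total : (A → ℚ) → List A → ℚ
  total w = foldr (λ x s → w x + s) 0ℚ

  total-++ : ∀ w xs ys → total w (xs ++ ys) ≡ total w xs + total w ys
  total-++ w [] ys = sym (ℚₚ.+-identityˡ (total w ys))
  total-++ w (x ∷ xs) ys = trans (cong (w x +_) (total-++ w xs ys)) (sym (ℚₚ.+-assoc (w x) _ _))

  total-↭ : ∀ w {xs ys} → xs ↭ ys → total w xs ≡ total w ys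
  total-↭ w ↭.refl = refl
  total-↭ w (prep x σ) = cong (w x +_) (total-↭ w σ)
  total-↭ w (swap x y σ) = trans (cong (λ s → w x + (w y + s)) (total-↭ w σ)) (exchange (w x) (w y) _)
    where exchange : ∀ a b s → a + (b + s) ≡ b + (a + s)
          exchange = solve 3 (λ a b s → a :+ (b :+ s) := b :+ (a :+ s)) refl
  total-↭ w (↭.trans σ τ) = trans (total-↭ w σ) (total-↭ w τ)

  total-affine : ∀ {w u z : A → ℚ} c → (∀ x → w x ≡ u x + z x * c) →
                 ∀ xs → total w xs ≡ total u xs + total z xs * c
  total-affine c eq [] = sym (p+0*q≡p 0ℚ c)
  total-affine {w} {u} {z} c eq (x ∷ xs) =
    trans (cong₂ _+_ (eq x) (total-affine {w} {u} {z} c eq xs)) (regroup (u x) (z x) (total u xs) (total z xs) c)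
    where regroup : ∀ a b s t c → (a + b * c) + (s + t * c) ≡ (a + s) + (b + t) * c
          regroup = solve 5 (λ a b s t c → (a :+ b :* c) :+ (s :+ t :* c) := (a :+ s) :+ (b :+ t) :* c) refl

  copies : ℕ → List A → List A
  copies zero xs = []
  copies (suc k) xs = xs ++ copies k xs

  total-copies : ∀ w k xs → total w (copies k xs) ≡ fromℕ k * total w xs
  total-copies w zero xs = sym (ℚₚ.*-zeroˡ (total w xs))
  total-copies w (suc k) xs = begin
    total w (xs ++ copies k xs)          ≡⟨ total-++ w xs (copies k xs) ⟩
    total w xs + total w (copies k xs)   ≡⟨ cong (total w xs +_) (total-copies w k xs) ⟩
    total w xs + fromℕ k * total w xs    ≡⟨ s+k*s≡[1+k]*s (total w xs) (fromℕ k) ⟩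
    (1ℚ + fromℕ k) * total w xs          ∎
    where
    open ≡-Reasoning
    s+k*s≡[1+k]*s : ∀ s k → s + k * s ≡ (1ℚ + k) * s
    s+k*s≡[1+k]*s = solve 2 (λ s k → s :+ k :* s := (con 1ℚ :+ k) :* s) refl

  copies-nonEmpty : ∀ {k xs} → k ≢ 0 → xs ≢ [] → copies k xs ≢ []
  copies-nonEmpty {zero} k≢0 _ = contradiction refl k≢0
  copies-nonEmpty {suc k} {[]} _ xs≢[] = contradiction refl xs≢[]
  copies-nonEmpty {suc k} {_ ∷ _} _ _ ()

_≟var_ : (A : Fm) (p : ℕ) → Dec (A ≡ var p)
var q ≟var p = map′ (cong var) (λ { refl → refl }) (q ℕ.≟ p)
t ≟var p = no λ ()
(_ ⊕ _) ≟var p = no λ ()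
¬' _ ≟var p = no λ ()
(_ ⟶ _) ≟var p = no λ ()
(_ ⟹ _) ≟var p = no λ ()

count : ℕ → List Fm → ℕ
count p = length ∘ filter (_≟var p)

count-++ : ∀ p xs ys → count p (xs ++ ys) ≡ count p xs ℕ.+ count p ys
count-++ p xs ys = trans (cong length (filter-++ (_≟var p) xs ys)) (length-++ (filter (_≟var p) xs))

count-↭ : ∀ p {xs ys} → xs ↭ ys → count p xs ≡ count p ys
count-↭ p σ = ↭-length (filter-↭ (_≟var p) σ)

count-self : ∀ p L → count p (var p ∷ L) ≡ suc (count p L)
count-self p L = cong length (filter-accept (_≟var p) refl)

count-other : ∀ {p q} L → q ≢ p → count p (var q ∷ L) ≡ count p L
count-other {p} {q} L q≢p = cong length (filter-reject (_≟var p) {var q} {L} λ { refl → q≢p refl })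

count≢0⇒∈ : ∀ p L → count p L ≢ 0 → var p ∈ L
count≢0⇒∈ p L count≢0 with any? (_≟var p) L
... | yes some = let A , A∈L , A≡p = find some in subst (_∈ L) A≡p A∈L
... | no none = contradiction (cong length (filter-none (_≟var p) (¬Any⇒All¬ L none))) count≢0

varView : ∀ {A} → IsVar A → ∃[ q ] A ≡ var q
varView {var q} _ = q , refl
varView {t} ()
varView {_ ⊕ _} ()
varView {¬' _} ()
varView {_ ⟶ _} ()
varView {_ ⟹ _} ()

↭-of-count≡ : ∀ {xs ys} → All IsVar xs → All IsVar ys → (∀ p → count p xs ≡ count p ys) → xs ↭ ys
↭-of-count≡ {[]} {[]} _ _ _ = ↭-refl
↭-of-count≡ {[]} {_ ∷ ys} _ (y-var ∷ _) same with varView y-var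
... | q , refl = contradiction (trans (same q) (count-self q ys)) λ ()
↭-of-count≡ {_ ∷ xs} {ys} (x-var ∷ xs-var) ys-var same with varView x-var
... | p , refl
  with ∈-∃++ (count≢0⇒∈ p ys λ ys≡0 → contradiction (trans (sym (count-self p xs)) (trans (same p) ys≡0)) λ ())
... | ys₁ , ys₂ , refl = ↭-trans (prep (var p) rest) (↭-sym σ)
  where
  σ = shift (var p) ys₁ ys₂
  rest : xs ↭ ys₁ ++ ys₂
  rest = ↭-of-count≡ xs-var (All.tail (All-resp-↭ σ ys-var)) λ q →
    ℕₚ.+-cancelˡ-≡ (count q [ var p ]) _ _ (begin
      count q [ var p ] ℕ.+ count q xs           ≡⟨ count-++ q [ var p ] xs ⟨
      count q (var p ∷ xs)                       ≡⟨ same q ⟩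
      count q (ys₁ ++ [ var p ] ++ ys₂)          ≡⟨ count-↭ q σ ⟩
      count q ([ var p ] ++ ys₁ ++ ys₂)          ≡⟨ count-++ q [ var p ] (ys₁ ++ ys₂) ⟩
      count q [ var p ] ℕ.+ count q (ys₁ ++ ys₂) ∎)
    where open ≡-Reasoning

sumV-affine : ∀ {v w : ℕ → ℚ} {p} → (∀ q → q ≢ p → w q ≡ v q) →
              ∀ {L} → All IsVar L → sumV w L ≡ sumV v L + fromℕ (count p L) * (w p - v p)
sumV-affine {v} {w} {p} agree [] = sym (p+0*q≡p 0ℚ (w p - v p))
sumV-affine {v} {w} {p} agree {_ ∷ L} (A-var ∷ L-var) with varView A-var
... | q , refl with q ℕ.≟ p
...   | yes refl = begin
  w p + sumV w L                                               ≡⟨ cong (w p +_) (sumV-affine agree L-var) ⟩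
  w p + (sumV v L + fromℕ (count p L) * (w p - v p))          ≡⟨ regroup (w p) (v p) (sumV v L) (fromℕ (count p L)) ⟩
  (v p + sumV v L) + (1ℚ + fromℕ (count p L)) * (w p - v p)
    ≡⟨ cong (λ k → (v p + sumV v L) + fromℕ k * (w p - v p)) (count-self p L) ⟨
  (v p + sumV v L) + fromℕ (count p (var p ∷ L)) * (w p - v p) ∎
  where
  open ≡-Reasoning
  regroup : ∀ w v s c → w + (s + c * (w - v)) ≡ (v + s) + (1ℚ + c) * (w - v)
  regroup = solve 4 (λ w v s c → w :+ (s :+ c :* (w :- v)) := (v :+ s) :+ (con 1ℚ :+ c) :* (w :- v)) refl
...   | no q≢p = begin
  w q + sumV w L                                               ≡⟨ cong₂ _+_ (agree q q≢p) (sumV-affine agree L-var) ⟩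
  v q + (sumV v L + fromℕ (count p L) * (w p - v p))          ≡⟨ ℚₚ.+-assoc (v q) _ _ ⟨
  (v q + sumV v L) + fromℕ (count p L) * (w p - v p)
    ≡⟨ cong (λ k → (v q + sumV v L) + fromℕ k * (w p - v p)) (count-other L q≢p) ⟨
  (v q + sumV v L) + fromℕ (count p (var q ∷ L)) * (w p - v p) ∎
  where open ≡-Reasoning

_[_≔_] : {A : Set} → (ℕ → A) → ℕ → A → ℕ → A
(f [ i ≔ a ]) j with j ℕ.≟ i
... | yes _ = a
... | no _ = f j

update-same : ∀ {A : Set} (f : ℕ → A) i a → (f [ i ≔ a ]) i ≡ a
update-same f i a with i ℕ.≟ i
... | yes _ = refl
... | no i≢i = contradiction refl i≢i

update-other : ∀ {A : Set} (f : ℕ → A) {i j} a → j ≢ i → (f [ i ≔ a ]) j ≡ f j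
update-other f {i} {j} a j≢i with j ℕ.≟ i
... | yes j≡i = contradiction j≡i j≢i
... | no _ = refl

labelBound : Label → ℕ
labelBound one = 0
labelBound (atom i) = suc i
labelBound (x · y) = labelBound x ℕ.⊔ labelBound y

occurs⇒<labelBound : ∀ {i x} → Occurs i x → i ℕ.< labelBound x
occurs⇒<labelBound here = ℕₚ.≤-refl
occurs⇒<labelBound (left {x} {y} o) =
  ℕₚ.<-≤-trans (occurs⇒<labelBound o) (ℕₚ.m≤m⊔n (labelBound x) (labelBound y))
occurs⇒<labelBound (right {x} {y} o) =
  ℕₚ.<-≤-trans (occurs⇒<labelBound o) (ℕₚ.m≤n⊔m (labelBound x) (labelBound y))

atomBound : List LFm → ℕ
atomBound [] = 0
atomBound ((x , _) ∷ L) = labelBound x ℕ.⊔ atomBound L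

occursIn⇒<atomBound : ∀ {i} L → OccursIn i L → i ℕ.< atomBound L
occursIn⇒<atomBound ((x , _) ∷ L) (here o) =
  ℕₚ.<-≤-trans (occurs⇒<labelBound o) (ℕₚ.m≤m⊔n (labelBound x) (atomBound L))
occursIn⇒<atomBound ((x , _) ∷ L) (there o) =
  ℕₚ.<-≤-trans (occursIn⇒<atomBound L o) (ℕₚ.m≤n⊔m (labelBound x) (atomBound L))

atomBound-fresh : ∀ L → ¬ OccursIn (atomBound L) L
atomBound-fresh L o = ℕₚ.<-irrefl refl (occursIn⇒<atomBound L o)

applyLab-cong : ∀ {f g} x → (∀ i → Occurs i x → f i ≡ g i) → applyLab f x ≡ applyLab g x
applyLab-cong one agree = refl
applyLab-cong (atom i) agree = agree i here
applyLab-cong (x · y) agree = cong₂ _∧_ (applyLab-cong x (λ i → agree i ∘ left)) (applyLab-cong y (λ i → agree i ∘ right))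

select-cong : ∀ {f g} L → (∀ i → OccursIn i L → f i ≡ g i) → select f L ≡ select g L
select-cong [] agree = refl
select-cong {f} {g} ((x , A) ∷ L) agree
  with applyLab f x | applyLab g x | applyLab-cong x (λ i → agree i ∘ here)
... | true  | true  | _ = cong (A ∷_) (select-cong L (λ i → agree i ∘ there))
... | false | false | _ = select-cong L (λ i → agree i ∘ there)

labellings : ℕ → List LabFun
labellings zero = [ (λ _ → false) ]
labellings (suc n) = cartesianProductWith (λ g b → g [ n ≔ b ]) (labellings n) (true ∷ false ∷ [])

labellings-complete : ∀ n (f : LabFun) → ∃[ g ] g ∈ labellings n × (∀ i → i ℕ.< n → f i ≡ g i)
labellings-complete zero f = _ , here refl , λ _ ()
labellings-complete (suc n) f with labellings-complete n f
... | g , g∈ , agree = g [ n ≔ f n ] , ∈-cartesianProductWith⁺ (λ g b → g [ n ≔ b ]) g∈ (bool∈ (f n)) , agree′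
  where
  bool∈ : ∀ b → b ∈ true ∷ false ∷ []
  bool∈ true = here refl
  bool∈ false = there (here refl)
  agree′ : ∀ i → i ℕ.< suc n → f i ≡ (g [ n ≔ f n ]) i
  agree′ i i<1+n with i ℕ.≟ n
  ... | yes refl = refl
  ... | no i≢n = agree i (ℕₚ.≤∧≢⇒< (ℕₚ.≤-pred i<1+n) i≢n)

kept : LabFun → LFm → Maybe Fm
kept f (x , A) = if applyLab f x then just A else nothing

select≡mapMaybe : ∀ f L → select f L ≡ mapMaybe (kept f) L
select≡mapMaybe f [] = refl
select≡mapMaybe f ((x , A) ∷ L) with applyLab f x
... | true  = cong (A ∷_) (select≡mapMaybe f L)
... | false = select≡mapMaybe f L

select-↭ : ∀ f {L L′} → L ↭ L′ → select f L ↭ select f L′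
select-↭ f {L} {L′} σ = subst₂ _↭_ (sym (select≡mapMaybe f L)) (sym (select≡mapMaybe f L′)) (mapMaybe-↭ (kept f) σ)

Atomic : List LFm → Set
Atomic = All (IsVar ∘ proj₂)

select-atomic : ∀ f {L} → Atomic L → All IsVar (select f L)
select-atomic f [] = []
select-atomic f {(x , A) ∷ L} (A-var ∷ L-atomic) with applyLab f x
... | true  = A-var ∷ select-atomic f L-atomic
... | false = select-atomic f L-atomic

selectAll-atomic : ∀ fs {L} → Atomic L → All IsVar (selectAll fs L)
selectAll-atomic [] L-atomic = []
selectAll-atomic (f ∷ fs) L-atomic = Allₚ.++⁺ (select-atomic f L-atomic) (selectAll-atomic fs L-atomic)

varIndex : Fm → List ℕ
varIndex (var q) = [ q ]
varIndex _ = []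

varsOf : List LFm → List ℕ
varsOf [] = []
varsOf ((_ , A) ∷ L) = varIndex A ++ varsOf L

∈-select⇒∈-varsOf : ∀ f L {q} → var q ∈ select f L → q ∈ varsOf L
∈-select⇒∈-varsOf f ((x , A) ∷ L) q∈ with applyLab f x | q∈
... | true  | here refl = here refl
... | true  | there q∈′ = ∈-++⁺ʳ (varIndex A) (∈-select⇒∈-varsOf f L q∈′)
... | false | q∈′ = ∈-++⁺ʳ (varIndex A) (∈-select⇒∈-varsOf f L q∈′)

count-select≡0 : ∀ f L {q} → q ∉ varsOf L → count q (select f L) ≡ 0
count-select≡0 f L {q} q∉ with count q (select f L) ℕ.≟ 0
... | yes count≡0 = count≡0
... | no count≢0 = contradiction (∈-select⇒∈-varsOf f L (count≢0⇒∈ q _ count≢0)) q∉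

-- A list fs of labelling functions stands for the sequent ⊎_{f ∈ fs} f(Γ) ⊢ ⊎_{f ∈ fs} f(Δ);
-- excess v fs is its left-minus-right value under v, imbalance p fs its left-minus-right number of
-- occurrences of the variable p.
module Elimination {Γ Δ : List LFm} (Γ-atomic : Atomic Γ) (Δ-atomic : Atomic Δ) where

  gap : (ℕ → ℚ) → LabFun → ℚ
  gap v f = sumV v (select f Γ) - sumV v (select f Δ)

  imb : ℕ → LabFun → ℚ
  imb p f = fromℕ (count p (select f Γ)) - fromℕ (count p (select f Δ))

  excess : (ℕ → ℚ) → List LabFun → ℚ
  excess v = total (gap v)

  imbalance : ℕ → List LabFun → ℚ
  imbalance p = total (imb p)

  Balanced : ℕ → List LabFun → Set
  Balanced p fs = imbalance p fs ≡ 0ℚ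

  module _ {v w : ℕ → ℚ} (p : ℕ) (agree : ∀ q → q ≢ p → w q ≡ v q) where

    excess-affine : ∀ fs → excess w fs ≡ excess v fs + imbalance p fs * (w p - v p)
    excess-affine = total-affine {w = gap w} {gap v} {imb p} (w p - v p) gap-affine
      where
      regroup : ∀ a b c d δ → (a + c * δ) - (b + d * δ) ≡ (a - b) + (c - d) * δ
      regroup = solve 5 (λ a b c d δ → (a :+ c :* δ) :- (b :+ d :* δ) := (a :- b) :+ (c :- d) :* δ) refl
      gap-affine : ∀ f → gap w f ≡ gap v f + imb p f * (w p - v p)
      gap-affine f = trans (cong₂ _-_ (sumV-affine agree (select-atomic f Γ-atomic))
                                      (sumV-affine agree (select-atomic f Δ-atomic)))
                           (regroup (sumV v (select f Γ)) (sumV v (select f Δ))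
                                    (fromℕ (count p (select f Γ))) (fromℕ (count p (select f Δ))) (w p - v p))

    excess-balanced : ∀ {fs} → Balanced p fs → excess w fs ≡ excess v fs
    excess-balanced {fs} balanced = trans (excess-affine fs)
      (trans (cong (λ a → excess v fs + a * (w p - v p)) balanced) (p+0*q≡p (excess v fs) (w p - v p)))

  imbalance≡ : ∀ p fs → imbalance p fs ≡ fromℕ (count p (selectAll fs Γ)) - fromℕ (count p (selectAll fs Δ))
  imbalance≡ p [] = refl
  imbalance≡ p (f ∷ fs) = begin
    imb p f + imbalance p fs
      ≡⟨ cong (imb p f +_) (imbalance≡ p fs) ⟩
    (fromℕ g₁ - fromℕ d₁) + (fromℕ g₂ - fromℕ d₂)
      ≡⟨ regroup (fromℕ g₁) (fromℕ d₁) (fromℕ g₂) (fromℕ d₂) ⟩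
    (fromℕ g₁ + fromℕ g₂) - (fromℕ d₁ + fromℕ d₂)
      ≡⟨ cong₂ _-_ (fromℕ-+ g₁ g₂) (fromℕ-+ d₁ d₂) ⟨
    fromℕ (g₁ ℕ.+ g₂) - fromℕ (d₁ ℕ.+ d₂)
      ≡⟨ cong₂ (λ g d → fromℕ g - fromℕ d) (count-++ p (select f Γ) _) (count-++ p (select f Δ) _) ⟨
    fromℕ (count p (selectAll (f ∷ fs) Γ)) - fromℕ (count p (selectAll (f ∷ fs) Δ)) ∎
    where
    open ≡-Reasoning
    g₁ = count p (select f Γ)
    d₁ = count p (select f Δ)
    g₂ = count p (selectAll fs Γ)
    d₂ = count p (selectAll fs Δ)
    regroup : ∀ a b c d → (a - b) + (c - d) ≡ (a + c) - (b + d)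
    regroup = solve 4 (λ a b c d → (a :- b) :+ (c :- d) := (a :+ c) :- (b :+ d)) refl

  balanced⇒↭ : ∀ {fs} → (∀ q → Balanced q fs) → selectAll fs Γ ↭ selectAll fs Δ
  balanced⇒↭ {fs} allBalanced = ↭-of-count≡ (selectAll-atomic fs Γ-atomic) (selectAll-atomic fs Δ-atomic)
    λ q → fromℕ-sub-injective (trans (sym (imbalance≡ q fs)) (allBalanced q))

  surplus deficit : ℕ → List LabFun → ℕ
  surplus p fs = count p (selectAll fs Γ) ∸ count p (selectAll fs Δ)
  deficit p fs = count p (selectAll fs Δ) ∸ count p (selectAll fs Γ)

  fromℕ-surplus : ∀ p fs → 0ℚ ≤ imbalance p fs → fromℕ (surplus p fs) ≡ imbalance p fs
  fromℕ-surplus p fs 0≤a =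
    trans (fromℕ-∸ {g} {d} (fromℕ-cancel-≤ (0≤q-p⇒p≤q (subst (0ℚ ≤_) (imbalance≡ p fs) 0≤a))))
          (sym (imbalance≡ p fs))
    where
    g = count p (selectAll fs Γ)
    d = count p (selectAll fs Δ)

  fromℕ-deficit : ∀ p fs → imbalance p fs ≤ 0ℚ → fromℕ (deficit p fs) ≡ - imbalance p fs
  fromℕ-deficit p fs a≤0 = begin
    fromℕ (deficit p fs)
      ≡⟨ fromℕ-∸ {d} {g} (fromℕ-cancel-≤ (p-q≤0⇒p≤q (subst (_≤ 0ℚ) (imbalance≡ p fs) a≤0))) ⟩
    fromℕ d - fromℕ g     ≡⟨ d-g≡-[g-d] (fromℕ g) (fromℕ d) ⟩
    - (fromℕ g - fromℕ d) ≡⟨ cong -_ (imbalance≡ p fs) ⟨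
    - imbalance p fs      ∎
    where
    open ≡-Reasoning
    g = count p (selectAll fs Γ)
    d = count p (selectAll fs Δ)
    d-g≡-[g-d] : ∀ g d → d - g ≡ - (g - d)
    d-g≡-[g-d] = solve 2 (λ g d → d :- g := :- (g :- d)) refl

  combine : ℕ → List LabFun → List LabFun → List LabFun
  combine p fs gs = copies (deficit p gs) fs ++ copies (surplus p fs) gs

  module _ {p fs gs} (0<a : 0ℚ < imbalance p fs) (a<0 : imbalance p gs < 0ℚ) where

    total-combine : ∀ w → total w (combine p fs gs) ≡ (- imbalance p gs) * total w fs + imbalance p fs * total w gs
    total-combine w = begin
      total w (copies (deficit p gs) fs ++ copies (surplus p fs) gs)
        ≡⟨ total-++ w (copies (deficit p gs) fs) _ ⟩
      total w (copies (deficit p gs) fs) + total w (copies (surplus p fs) gs)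
        ≡⟨ cong₂ _+_ (total-copies w (deficit p gs) fs) (total-copies w (surplus p fs) gs) ⟩
      fromℕ (deficit p gs) * total w fs + fromℕ (surplus p fs) * total w gs
        ≡⟨ cong₂ (λ k l → k * total w fs + l * total w gs)
                 (fromℕ-deficit p gs (ℚₚ.<⇒≤ a<0)) (fromℕ-surplus p fs (ℚₚ.<⇒≤ 0<a)) ⟩
      (- imbalance p gs) * total w fs + imbalance p fs * total w gs ∎
      where open ≡-Reasoning

    combine-balanced : Balanced p (combine p fs gs)
    combine-balanced = trans (total-combine (imb p)) (-b*a+a*b≡0 (imbalance p fs) (imbalance p gs))
      where -b*a+a*b≡0 : ∀ a b → (- b) * a + a * b ≡ 0ℚ
            -b*a+a*b≡0 = solve 2 (λ a b → (:- b) :* a :+ a :* b := con 0ℚ) refl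

    combine-preserves-balanced : ∀ {q} → Balanced q fs → Balanced q gs → Balanced q (combine p fs gs)
    combine-preserves-balanced {q} fs-balanced gs-balanced =
      trans (total-combine (imb q))
            (trans (cong₂ (λ x y → (- imbalance p gs) * x + imbalance p fs * y) fs-balanced gs-balanced)
                   (-b*0+a*0≡0 (imbalance p fs) (imbalance p gs)))
      where -b*0+a*0≡0 : ∀ a b → (- b) * 0ℚ + a * 0ℚ ≡ 0ℚ
            -b*0+a*0≡0 = solve 2 (λ a b → (:- b) :* con 0ℚ :+ a :* con 0ℚ := con 0ℚ) refl

    combine-nonEmpty : gs ≢ [] → combine p fs gs ≢ []
    combine-nonEmpty gs≢[] = ++-nonEmptyʳ (copies-nonEmpty surplus≢0 gs≢[])
      where
      surplus≢0 : surplus p fs ≢ 0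
      surplus≢0 s≡0 = ℚₚ.<-irrefl (trans (cong fromℕ (sym s≡0)) (fromℕ-surplus p fs (ℚₚ.<⇒≤ 0<a))) 0<a
      ++-nonEmptyʳ : ∀ {xs ys : List LabFun} → ys ≢ [] → xs ++ ys ≢ []
      ++-nonEmptyʳ {[]} ys≢[] = ys≢[]
      ++-nonEmptyʳ {_ ∷ _} _ ()

  balanced? : ∀ p fs → Dec (Balanced p fs)
  balanced? p fs = imbalance p fs ℚₚ.≟ 0ℚ

  rising? : ∀ p fs → Dec (0ℚ < imbalance p fs)
  rising? p fs = 0ℚ ℚₚ.<? imbalance p fs

  falling? : ∀ p fs → Dec (imbalance p fs < 0ℚ)
  falling? p fs = imbalance p fs ℚₚ.<? 0ℚ

  eliminate : ℕ → List (List LabFun) → List (List LabFun)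
  eliminate p SS = filter (balanced? p) SS
                ++ cartesianProductWith (combine p) (filter (rising? p) SS) (filter (falling? p) SS)

  balanced∈eliminate : ∀ {p SS fs} → fs ∈ SS → Balanced p fs → fs ∈ eliminate p SS
  balanced∈eliminate {p} fs∈ bal = ∈-++⁺ˡ (∈-filter⁺ (balanced? p) fs∈ bal)

  combine∈eliminate : ∀ {p SS fs gs} → fs ∈ SS → gs ∈ SS → 0ℚ < imbalance p fs → imbalance p gs < 0ℚ →
                      combine p fs gs ∈ eliminate p SS
  combine∈eliminate {p} {SS} fs∈ gs∈ 0<a a<0 =
    ∈-++⁺ʳ (filter (balanced? p) SS)
           (∈-cartesianProductWith⁺ (combine p) (∈-filter⁺ (rising? p) fs∈ 0<a) (∈-filter⁺ (falling? p) gs∈ a<0))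

  data FromEliminate (p : ℕ) (SS : List (List LabFun)) : List LabFun → Set where
    balanced : ∀ {fs} → fs ∈ SS → Balanced p fs → FromEliminate p SS fs
    combined : ∀ {fs gs} → fs ∈ SS → gs ∈ SS → 0ℚ < imbalance p fs → imbalance p gs < 0ℚ →
               FromEliminate p SS (combine p fs gs)

  ∈-eliminate⁻ : ∀ {p SS hs} → hs ∈ eliminate p SS → FromEliminate p SS hs
  ∈-eliminate⁻ {p} {SS} hs∈ with ∈-++⁻ (filter (balanced? p) SS) hs∈
  ... | inj₁ hs∈kept = let hs∈SS , bal = ∈-filter⁻ (balanced? p) hs∈kept in balanced hs∈SS bal
  ... | inj₂ hs∈comb with ∈-cartesianProductWith⁻ (combine p) (filter (rising? p) SS) (filter (falling? p) SS) hs∈comb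
  ...   | fs , gs , fs∈ , gs∈ , refl with ∈-filter⁻ (rising? p) fs∈ | ∈-filter⁻ (falling? p) gs∈
  ...     | fs∈SS , 0<a | gs∈SS , a<0 = combined fs∈SS gs∈SS 0<a a<0

  Covers : List (List LabFun) → Set
  Covers SS = ∀ v → ∃[ fs ] fs ∈ SS × excess v fs ≤ 0ℚ

  -- If no new member had nonpositive excess at v, then as functions of the value τ of p the old
  -- members' excesses at v[p ≔ τ] would satisfy the hypotheses of strictAffineSystem-solvable.
  eliminate-covers : ∀ p SS → Covers SS → Covers (eliminate p SS)
  eliminate-covers p SS covers v with any? (λ fs → excess v fs ℚₚ.≤? 0ℚ) (eliminate p SS)
  ... | yes some = find some
  ... | no none = ⊥-elim (refute (strictAffineSystem-solvable a b SS flat-ok opposite-ok))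
    where
    v₀ = v [ p ≔ 0ℚ ]
    a b : List LabFun → ℚ
    a = imbalance p
    b = excess v₀

    0<excess : ∀ {fs} → fs ∈ eliminate p SS → 0ℚ < excess v fs
    0<excess fs∈ = ℚₚ.≰⇒> (λ le → none (lose fs∈ le))

    v≈v₀ : ∀ q → q ≢ p → v q ≡ v₀ q
    v≈v₀ q q≢p = sym (update-other v 0ℚ q≢p)

    flat-ok : ∀ {fs} → fs ∈ SS → a fs ≡ 0ℚ → 0ℚ < b fs
    flat-ok {fs} fs∈ bal =
      subst (0ℚ <_) (excess-balanced p v≈v₀ {fs} bal) (0<excess {fs} (balanced∈eliminate {p} {SS} fs∈ bal))

    opposite-ok : ∀ {fs gs} → fs ∈ SS → gs ∈ SS → 0ℚ < a fs → a gs < 0ℚ → 0ℚ < (- a gs) * b fs + a fs * b gs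
    opposite-ok {fs} {gs} fs∈ gs∈ 0<a a<0 =
      subst (0ℚ <_) (trans (excess-balanced p v≈v₀ {combine p fs gs} (combine-balanced {p} {fs} {gs} 0<a a<0))
                           (total-combine {p} {fs} {gs} 0<a a<0 (gap v₀)))
            (0<excess {combine p fs gs} (combine∈eliminate {p} {SS} fs∈ gs∈ 0<a a<0))

    excess-at : ∀ τ fs → excess (v [ p ≔ τ ]) fs ≡ b fs + a fs * τ
    excess-at τ fs = begin
      excess (v [ p ≔ τ ]) fs
        ≡⟨ excess-affine p (λ q q≢p → trans (update-other v τ q≢p) (v≈v₀ q q≢p)) fs ⟩
      b fs + a fs * ((v [ p ≔ τ ]) p - v₀ p)
        ≡⟨ cong₂ (λ x y → b fs + a fs * (x - y)) (update-same v p τ) (update-same v p 0ℚ) ⟩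
      b fs + a fs * (τ - 0ℚ)                  ≡⟨ cong (λ x → b fs + a fs * x) (ℚₚ.+-identityʳ τ) ⟩
      b fs + a fs * τ                         ∎
      where open ≡-Reasoning

    refute : ∃[ τ ] (∀ {fs} → fs ∈ SS → 0ℚ < b fs + a fs * τ) → ⊥
    refute (τ , satisfied) with covers (v [ p ≔ τ ])
    ... | fs , fs∈ , le = ℚₚ.<-irrefl refl (ℚₚ.<-≤-trans (subst (0ℚ <_) (sym (excess-at τ fs)) (satisfied fs∈)) le)

  record Admissible (ps : List ℕ) (SS : List (List LabFun)) : Set where
    field
      nonEmpty    : ∀ {fs} → fs ∈ SS → fs ≢ []
      balancedOff : ∀ {fs} → fs ∈ SS → ∀ q → q ∈ ps ⊎ Balanced q fs
      covers      : Covers SS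

  eliminate-admissible : ∀ {p ps SS} → Admissible (p ∷ ps) SS → Admissible ps (eliminate p SS)
  eliminate-admissible {p} {ps} {SS} adm = record
    { nonEmpty    = nonEmpty′ ∘ ∈-eliminate⁻
    ; balancedOff = balancedOff′ ∘ ∈-eliminate⁻
    ; covers      = eliminate-covers p SS covers
    }
    where
    open Admissible adm
    nonEmpty′ : ∀ {hs} → FromEliminate p SS hs → hs ≢ []
    nonEmpty′ (balanced fs∈ _) = nonEmpty fs∈
    nonEmpty′ (combined {fs} {gs} _ gs∈ 0<a a<0) = combine-nonEmpty {p} {fs} {gs} 0<a a<0 (nonEmpty gs∈)
    balancedOff′ : ∀ {hs} → FromEliminate p SS hs → ∀ q → q ∈ ps ⊎ Balanced q hs
    balancedOff′ (balanced fs∈ bal) q with balancedOff fs∈ q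
    ... | inj₁ (here refl) = inj₂ bal
    ... | inj₁ (there q∈ps) = inj₁ q∈ps
    ... | inj₂ bal-q = inj₂ bal-q
    balancedOff′ (combined {fs} {gs} fs∈ gs∈ 0<a a<0) q with balancedOff fs∈ q | balancedOff gs∈ q
    ... | inj₁ (there q∈ps) | _ = inj₁ q∈ps
    ... | _ | inj₁ (there q∈ps) = inj₁ q∈ps
    ... | inj₁ (here refl) | _ = inj₂ (combine-balanced {p} {fs} {gs} 0<a a<0)
    ... | inj₂ _ | inj₁ (here refl) = inj₂ (combine-balanced {p} {fs} {gs} 0<a a<0)
    ... | inj₂ fs-balanced | inj₂ gs-balanced =
      inj₂ (combine-preserves-balanced {p} {fs} {gs} 0<a a<0 fs-balanced gs-balanced)

  balancedCombination : ∀ ps SS → Admissible ps SS → ∃[ fs ] fs ≢ [] × (∀ q → Balanced q fs)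
  balancedCombination [] SS adm with Admissible.covers adm (λ _ → 0ℚ)
  ... | fs , fs∈ , _ = fs , Admissible.nonEmpty adm fs∈ , λ q → balancedAt q (Admissible.balancedOff adm fs∈ q)
    where balancedAt : ∀ q → q ∈ [] ⊎ Balanced q fs → Balanced q fs
          balancedAt q (inj₂ bal) = bal
  balancedCombination (p ∷ ps) SS adm = balancedCombination ps (eliminate p SS) (eliminate-admissible adm)

  labellings-admissible : Valid Γ Δ →
    Admissible (varsOf Γ ++ varsOf Δ) (map [_] (labellings (atomBound (Γ ++ Δ))))
  labellings-admissible valid = record
    { nonEmpty    = λ fs∈ → singleton (∈-map⁻ [_] fs∈)
    ; balancedOff = λ fs∈ → balancedOff′ (∈-map⁻ [_] fs∈)
    ; covers      = covers′
    }
    where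
    N = atomBound (Γ ++ Δ)
    singleton : ∀ {fs} → ∃[ g ] g ∈ labellings N × fs ≡ [ g ] → fs ≢ []
    singleton (g , _ , refl) ()
    balancedOff′ : ∀ {fs} → ∃[ g ] g ∈ labellings N × fs ≡ [ g ] → ∀ q → q ∈ varsOf Γ ++ varsOf Δ ⊎ Balanced q fs
    balancedOff′ (g , _ , refl) q with q ∈? varsOf Γ ++ varsOf Δ
    ... | yes q∈ = inj₁ q∈
    ... | no q∉ = inj₂ (begin
      (fromℕ (count q (select g Γ)) - fromℕ (count q (select g Δ))) + 0ℚ
        ≡⟨ cong₂ (λ m n → (fromℕ m - fromℕ n) + 0ℚ) (count-select≡0 g Γ (q∉ ∘ ∈-++⁺ˡ))
                                                  (count-select≡0 g Δ (q∉ ∘ ∈-++⁺ʳ (varsOf Γ))) ⟩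
      0ℚ ∎)
      where open ≡-Reasoning
    covers′ : Covers (map [_] (labellings N))
    covers′ v with valid v
    ... | f , f-valid with labellings-complete N f
    ...   | g , g∈ , agree = [ g ] , ∈-map⁺ [_] g∈ ,
      subst (_≤ 0ℚ) (sym (ℚₚ.+-identityʳ (gap v g)))
            (p≤q⇒p-q≤0 (subst₂ (λ G D → sumV v G ≤ sumV v D) (select-cong Γ agreeΓ) (select-cong Δ agreeΔ) f-valid))
      where
      agreeΓ : ∀ i → OccursIn i Γ → f i ≡ g i
      agreeΓ i o = agree i (occursIn⇒<atomBound (Γ ++ Δ) (++⁺ˡ o))
      agreeΔ : ∀ i → OccursIn i Δ → f i ≡ g i
      agreeΔ i o = agree i (occursIn⇒<atomBound (Γ ++ Δ) (++⁺ʳ Γ o))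

atomic-complete : ∀ {Γ Δ} → Atomic Γ → Atomic Δ → Valid Γ Δ → Γ ⊢ Δ
atomic-complete Γ-atomic Δ-atomic valid =
  let fs , fs≢[] , allBalanced = balancedCombination _ _ (labellings-admissible valid)
  in success Γ-atomic Δ-atomic fs fs≢[] (balanced⇒↭ {fs} allBalanced)
  where open Elimination Γ-atomic Δ-atomic

-- Invertibility of the rules

infix 6 _∶*_
_∶*_ : Label → List Fm → List LFm
x ∶* As = map (x ,_) As

gate : Bool → ℚ → ℚ
gate b q = if b then q else 0ℚ

gate-mono : ∀ c {a b a′ b′} → a′ - b′ ≤ a - b → gate c a′ - gate c b′ ≤ gate c a - gate c b
gate-mono true a′-b′≤a-b = a′-b′≤a-b
gate-mono false _ = ℚₚ.≤-refl

sumV-select-∶* : ∀ v f x As L → sumV v (select f (x ∶* As ++ L)) ≡ gate (applyLab f x) (sumV v As) + sumV v (select f L)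
sumV-select-∶* v f x [] L with applyLab f x
... | true  = sym (ℚₚ.+-identityˡ _)
... | false = sym (ℚₚ.+-identityˡ _)
sumV-select-∶* v f x (A ∷ As) L with applyLab f x | sumV-select-∶* v f x As L
... | true  | ih = trans (cong (⟦ A ⟧ v +_) ih) (sym (ℚₚ.+-assoc (⟦ A ⟧ v) (sumV v As) _))
... | false | ih = ih

Valid-transfer : ∀ {Γ Δ} x y Asᶜ Bsᶜ Asᵖ Bsᵖ →
  (∀ v f → ∃[ f′ ] select f′ Γ ≡ select f Γ × select f′ Δ ≡ select f Δ ×
     gate (applyLab f′ y) (sumV v Asᵖ) - gate (applyLab f′ y) (sumV v Bsᵖ)
       ≤ gate (applyLab f x) (sumV v Asᶜ) - gate (applyLab f x) (sumV v Bsᶜ)) →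
  Valid (x ∶* Asᶜ ++ Γ) (x ∶* Bsᶜ ++ Δ) → Valid (y ∶* Asᵖ ++ Γ) (y ∶* Bsᵖ ++ Δ)
Valid-transfer {Γ} {Δ} x y Asᶜ Bsᶜ Asᵖ Bsᵖ transfer valid v with valid v
... | f , f-valid with transfer v f
...   | f′ , sameΓ , sameΔ , local = f′ ,
  subst₂ _≤_ (sym (trans (sumV-select-∶* v f′ y Asᵖ Γ) (cong (λ L → a′ + sumV v L) sameΓ)))
             (sym (trans (sumV-select-∶* v f′ y Bsᵖ Δ) (cong (λ L → b′ + sumV v L) sameΔ)))
             (≤-replace {a} {b} {a′} {b′} local
               (subst₂ _≤_ (sumV-select-∶* v f x Asᶜ Γ) (sumV-select-∶* v f x Bsᶜ Δ) f-valid))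
  where
  a = gate (applyLab f x) (sumV v Asᶜ)
  b = gate (applyLab f x) (sumV v Bsᶜ)
  a′ = gate (applyLab f′ y) (sumV v Asᵖ)
  b′ = gate (applyLab f′ y) (sumV v Bsᵖ)

Valid-local : ∀ {Γ Δ} x Asᶜ Bsᶜ Asᵖ Bsᵖ →
  (∀ v → sumV v Asᵖ - sumV v Bsᵖ ≤ sumV v Asᶜ - sumV v Bsᶜ) →
  Valid (x ∶* Asᶜ ++ Γ) (x ∶* Bsᶜ ++ Δ) → Valid (x ∶* Asᵖ ++ Γ) (x ∶* Bsᵖ ++ Δ)
Valid-local x Asᶜ Bsᶜ Asᵖ Bsᵖ local =
  Valid-transfer x x Asᶜ Bsᶜ Asᵖ Bsᵖ λ v f → f , refl , refl , gate-mono (applyLab f x) (local v)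

Valid-↭ : ∀ {Γ Γ′ Δ Δ′} → Γ ↭ Γ′ → Δ ↭ Δ′ → Valid Γ Δ → Valid Γ′ Δ′
Valid-↭ σ τ valid v with valid v
... | f , f-valid =
  f , subst₂ _≤_ (total-↭ (λ A → ⟦ A ⟧ v) (select-↭ f σ)) (total-↭ (λ A → ⟦ A ⟧ v) (select-↭ f τ)) f-valid

-q≡0-[q+0] : ∀ q → - q ≡ 0ℚ - (q + 0ℚ)
-q≡0-[q+0] = solve 1 (λ q → :- q := con 0ℚ :- (q :+ con 0ℚ)) refl

module _ {Γ Δ : List LFm} {x : Label} where

  invert-t-l : Valid ((x ∶ t) ∷ Γ) Δ → Valid Γ Δ
  invert-t-l = Valid-local {Γ} {Δ} x [ t ] [] [] [] λ _ → ℚₚ.≤-refl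

  invert-t-r : Valid Γ ((x ∶ t) ∷ Δ) → Valid Γ Δ
  invert-t-r = Valid-local {Γ} {Δ} x [] [ t ] [] [] λ _ → ℚₚ.≤-refl

  invert-¬-l : ∀ {A} → Valid ((x ∶ ¬' A) ∷ Γ) Δ → Valid Γ ((x ∶ A) ∷ Δ)
  invert-¬-l {A} = Valid-local {Γ} {Δ} x [ ¬' A ] [] [] [ A ] λ v → ℚₚ.≤-reflexive (identity (⟦ A ⟧ v))
    where identity : ∀ a → 0ℚ - (a + 0ℚ) ≡ (- a + 0ℚ) - 0ℚ
          identity = solve 1 (λ a → con 0ℚ :- (a :+ con 0ℚ) := (:- a :+ con 0ℚ) :- con 0ℚ) refl

  invert-¬-r : ∀ {A} → Valid Γ ((x ∶ ¬' A) ∷ Δ) → Valid ((x ∶ A) ∷ Γ) Δ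
  invert-¬-r {A} = Valid-local {Γ} {Δ} x [] [ ¬' A ] [ A ] [] λ v → ℚₚ.≤-reflexive (identity (⟦ A ⟧ v))
    where identity : ∀ a → (a + 0ℚ) - 0ℚ ≡ 0ℚ - (- a + 0ℚ)
          identity = solve 1 (λ a → (a :+ con 0ℚ) :- con 0ℚ := con 0ℚ :- (:- a :+ con 0ℚ)) refl

  invert-⊕-l : ∀ {A B} → Valid ((x ∶ A ⊕ B) ∷ Γ) Δ → Valid ((x ∶ A) ∷ (x ∶ B) ∷ Γ) Δ
  invert-⊕-l {A} {B} = Valid-local {Γ} {Δ} x [ A ⊕ B ] [] (A ∷ B ∷ []) [] λ v →
    ℚₚ.≤-reflexive (identity (⟦ A ⟧ v) (⟦ B ⟧ v))
    where identity : ∀ a b → (a + (b + 0ℚ)) - 0ℚ ≡ ((a + b) + 0ℚ) - 0ℚ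
          identity = solve 2 (λ a b → (a :+ (b :+ con 0ℚ)) :- con 0ℚ := ((a :+ b) :+ con 0ℚ) :- con 0ℚ) refl

  invert-⊕-r : ∀ {A B} → Valid Γ ((x ∶ A ⊕ B) ∷ Δ) → Valid Γ ((x ∶ A) ∷ (x ∶ B) ∷ Δ)
  invert-⊕-r {A} {B} = Valid-local {Γ} {Δ} x [] [ A ⊕ B ] [] (A ∷ B ∷ []) λ v →
    ℚₚ.≤-reflexive (identity (⟦ A ⟧ v) (⟦ B ⟧ v))
    where identity : ∀ a b → 0ℚ - (a + (b + 0ℚ)) ≡ 0ℚ - ((a + b) + 0ℚ)
          identity = solve 2 (λ a b → con 0ℚ :- (a :+ (b :+ con 0ℚ)) := con 0ℚ :- ((a :+ b) :+ con 0ℚ)) refl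

  invert-⟶-l : ∀ {A B} → Valid ((x ∶ A ⟶ B) ∷ Γ) Δ → Valid ((x ∶ B) ∷ Γ) ((x ∶ A) ∷ Δ)
  invert-⟶-l {A} {B} = Valid-local {Γ} {Δ} x [ A ⟶ B ] [] [ B ] [ A ] λ v →
    ℚₚ.≤-reflexive (identity (⟦ A ⟧ v) (⟦ B ⟧ v))
    where identity : ∀ a b → (b + 0ℚ) - (a + 0ℚ) ≡ ((b - a) + 0ℚ) - 0ℚ
          identity = solve 2 (λ a b → (b :+ con 0ℚ) :- (a :+ con 0ℚ) := ((b :- a) :+ con 0ℚ) :- con 0ℚ) refl

  invert-⟶-r : ∀ {A B} → Valid Γ ((x ∶ A ⟶ B) ∷ Δ) → Valid ((x ∶ A) ∷ Γ) ((x ∶ B) ∷ Δ)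
  invert-⟶-r {A} {B} = Valid-local {Γ} {Δ} x [] [ A ⟶ B ] [ A ] [ B ] λ v →
    ℚₚ.≤-reflexive (identity (⟦ A ⟧ v) (⟦ B ⟧ v))
    where identity : ∀ a b → (a + 0ℚ) - (b + 0ℚ) ≡ 0ℚ - ((b - a) + 0ℚ)
          identity = solve 2 (λ a b → (a :+ con 0ℚ) :- (b :+ con 0ℚ) := con 0ℚ :- ((b :- a) :+ con 0ℚ)) refl

  invert-⟹-r₁ : ∀ {A B} → Valid Γ ((x ∶ A ⟹ B) ∷ Δ) → Valid ((x ∶ A) ∷ Γ) ((x ∶ B) ∷ Δ)
  invert-⟹-r₁ {A} {B} = Valid-local {Γ} {Δ} x [] [ A ⟹ B ] [ A ] [ B ] λ v →
    subst₂ _≤_ (identity (⟦ A ⟧ v) (⟦ B ⟧ v)) (-q≡0-[q+0] (0ℚ ⊓ (⟦ B ⟧ v - ⟦ A ⟧ v)))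
               (ℚₚ.neg-antimono-≤ (ℚₚ.p⊓q≤q 0ℚ (⟦ B ⟧ v - ⟦ A ⟧ v)))
    where identity : ∀ a b → - (b - a) ≡ (a + 0ℚ) - (b + 0ℚ)
          identity = solve 2 (λ a b → :- (b :- a) := (a :+ con 0ℚ) :- (b :+ con 0ℚ)) refl

  invert-⟹-r₂ : ∀ {A B} → Valid Γ ((x ∶ A ⟹ B) ∷ Δ) → Valid Γ Δ
  invert-⟹-r₂ {A} {B} = Valid-local {Γ} {Δ} x [] [ A ⟹ B ] [] [] λ v →
    subst₂ _≤_ refl (-q≡0-[q+0] (0ℚ ⊓ (⟦ B ⟧ v - ⟦ A ⟧ v)))
               (ℚₚ.neg-antimono-≤ (ℚₚ.p⊓q≤p 0ℚ (⟦ B ⟧ v - ⟦ A ⟧ v)))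

⟹-l-local : ∀ γ a b → ∃[ c ] gate (γ ∧ c) (b + 0ℚ) - gate (γ ∧ c) (a + 0ℚ)
                              ≤ gate γ (0ℚ ⊓ (b - a) + 0ℚ) - gate γ 0ℚ
⟹-l-local false a b = false , ℚₚ.≤-refl
⟹-l-local true a b with (b - a) ℚₚ.≤? 0ℚ
... | yes b-a≤0 =
  true , ℚₚ.≤-reflexive (trans (identity a b) (cong (λ m → (m + 0ℚ) - 0ℚ) (sym (ℚₚ.p≥q⇒p⊓q≡q b-a≤0))))
  where identity : ∀ a b → (b + 0ℚ) - (a + 0ℚ) ≡ ((b - a) + 0ℚ) - 0ℚ
        identity = solve 2 (λ a b → (b :+ con 0ℚ) :- (a :+ con 0ℚ) := ((b :- a) :+ con 0ℚ) :- con 0ℚ) refl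
... | no b-a≰0 =
  false , ℚₚ.≤-reflexive (cong (λ m → (m + 0ℚ) - 0ℚ) (sym (ℚₚ.p≤q⇒p⊓q≡p (ℚₚ.<⇒≤ (ℚₚ.≰⇒> b-a≰0)))))

invert-⟹-l : ∀ {Γ Δ x A B} i → ¬ OccursIn i ((x ∶ A ⟹ B) ∷ Γ) → ¬ OccursIn i Δ →
             Valid ((x ∶ A ⟹ B) ∷ Γ) Δ → Valid ((x · atom i ∶ B) ∷ Γ) ((x · atom i ∶ A) ∷ Δ)
invert-⟹-l {Γ} {Δ} {x} {A} {B} i fresh-l fresh-r =
  Valid-transfer {Γ} {Δ} x (x · atom i) [ A ⟹ B ] [] [ B ] [ A ] relabel
  where
  relabel : ∀ v f → ∃[ f′ ] select f′ Γ ≡ select f Γ × select f′ Δ ≡ select f Δ ×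
    gate (applyLab f′ (x · atom i)) (sumV v [ B ]) - gate (applyLab f′ (x · atom i)) (sumV v [ A ])
      ≤ gate (applyLab f x) (sumV v [ A ⟹ B ]) - gate (applyLab f x) (sumV v [])
  relabel v f with ⟹-l-local (applyLab f x) (⟦ A ⟧ v) (⟦ B ⟧ v)
  ... | c , local = f′ , select-cong Γ (λ j → off j (fresh-l ∘ there)) , select-cong Δ (λ j → off j fresh-r) ,
                    subst (λ β → gate β (⟦ B ⟧ v + 0ℚ) - gate β (⟦ A ⟧ v + 0ℚ) ≤ _) (sym labelled) local
    where
    f′ = f [ i ≔ c ]
    off : ∀ {L} j → ¬ OccursIn i L → OccursIn j L → f′ j ≡ f j
    off {L} j fresh o = update-other f c λ j≡i → fresh (subst (λ k → OccursIn k L) j≡i o)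
    labelled : applyLab f′ (x · atom i) ≡ applyLab f x ∧ c
    labelled = cong₂ _∧_ (applyLab-cong x λ j o → off′ j o) (update-same f i c)
      where off′ : ∀ j → Occurs j x → f′ j ≡ f j
            off′ j o = update-other f c λ j≡i → fresh-l (here (subst (λ k → Occurs k x) j≡i o))

-- Proof search

isVar? : ∀ A → Dec (IsVar A)
isVar? (var _) = yes _
isVar? t = no λ ()
isVar? (_ ⊕ _) = no λ ()
isVar? (¬' _) = no λ ()
isVar? (_ ⟶ _) = no λ ()
isVar? (_ ⟹ _) = no λ ()

compound-↭ : ∀ L → ¬ Atomic L → ∃[ x ] ∃[ A ] ∃[ L′ ] ¬ IsVar A × L ↭ (x , A) ∷ L′
compound-↭ L ¬atomic with find (¬All⇒Any¬ (isVar? ∘ proj₂) L ¬atomic)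
... | (x , A) , xA∈L , ¬var with ∈-∃++ xA∈L
...   | L₁ , L₂ , refl = x , A , L₁ ++ L₂ , ¬var , shift (x , A) L₁ L₂

size : Fm → ℕ
size (var _) = 0
size t = 1
size (A ⊕ B) = suc (size A ℕ.+ size B)
size (¬' A) = suc (size A)
size (A ⟶ B) = suc (size A ℕ.+ size B)
size (A ⟹ B) = suc (size A ℕ.+ size B)

weight : List LFm → ℕ
weight = sum ∘ map (size ∘ proj₂)

weight-↭ : ∀ {L L′} → L ↭ L′ → weight L ≡ weight L′
weight-↭ σ = sum-↭ (map⁺ (size ∘ proj₂) σ)

¬-l-weight : ∀ a g d → suc ((a ℕ.+ g) ℕ.+ d) ≡ suc (g ℕ.+ (a ℕ.+ d))
¬-l-weight = solve-∀

⊕-l-weight : ∀ a b g d → suc (((a ℕ.+ b) ℕ.+ g) ℕ.+ d) ≡ suc ((a ℕ.+ (b ℕ.+ g)) ℕ.+ d)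
⊕-l-weight = solve-∀

binary-l-weight : ∀ a b g d → suc (((a ℕ.+ b) ℕ.+ g) ℕ.+ d) ≡ suc ((b ℕ.+ g) ℕ.+ (a ℕ.+ d))
binary-l-weight = solve-∀

¬-r-weight : ∀ a g d → g ℕ.+ suc (a ℕ.+ d) ≡ suc ((a ℕ.+ g) ℕ.+ d)
¬-r-weight = solve-∀

⊕-r-weight : ∀ a b g d → g ℕ.+ suc ((a ℕ.+ b) ℕ.+ d) ≡ suc (g ℕ.+ (a ℕ.+ (b ℕ.+ d)))
⊕-r-weight = solve-∀

binary-r-weight : ∀ a b g d → g ℕ.+ suc ((a ℕ.+ b) ℕ.+ d) ≡ suc ((a ℕ.+ g) ℕ.+ (b ℕ.+ d))
binary-r-weight = solve-∀

mutual
  search : ∀ n Γ Δ → weight Γ ℕ.+ weight Δ ℕ.< n → Valid Γ Δ → Γ ⊢ Δ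
  search (suc n) Γ Δ (s≤s w≤n) valid with all? (isVar? ∘ proj₂) Γ | all? (isVar? ∘ proj₂) Δ
  ... | yes Γ-atomic | yes Δ-atomic = atomic-complete Γ-atomic Δ-atomic valid
  ... | no ¬Γ-atomic | _ with compound-↭ Γ ¬Γ-atomic
  ...   | x , A , Γ′ , compound , σ =
    perm (↭-sym σ) ↭-refl
      (searchLeft n x A Γ′ Δ compound (subst (λ w → w ℕ.+ weight Δ ℕ.≤ n) (weight-↭ σ) w≤n)
                  (Valid-↭ {Γ} {(x , A) ∷ Γ′} {Δ} {Δ} σ ↭-refl valid))
  search (suc n) Γ Δ (s≤s w≤n) valid | yes _ | no ¬Δ-atomic with compound-↭ Δ ¬Δ-atomic
  ...   | x , A , Δ′ , compound , σ =
    perm ↭-refl (↭-sym σ)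
      (searchRight n x A Γ Δ′ compound (subst (λ w → weight Γ ℕ.+ w ℕ.≤ n) (weight-↭ σ) w≤n)
                   (Valid-↭ {Γ} {Γ} {Δ} {(x , A) ∷ Δ′} ↭-refl σ valid))

  searchLeft : ∀ n x A Γ Δ → ¬ IsVar A → weight ((x ∶ A) ∷ Γ) ℕ.+ weight Δ ℕ.≤ n →
               Valid ((x ∶ A) ∷ Γ) Δ → (x ∶ A) ∷ Γ ⊢ Δ
  searchLeft n x (var _) Γ Δ compound = contradiction _ compound
  searchLeft n x t Γ Δ _ w≤n valid =
    t-l (search n Γ Δ w≤n (invert-t-l {Γ} {Δ} {x} valid))
  searchLeft n x (¬' A) Γ Δ _ w≤n valid =
    ¬-l (search n Γ ((x ∶ A) ∷ Δ) (subst (ℕ._≤ n) (¬-l-weight (size A) (weight Γ) (weight Δ)) w≤n)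
                (invert-¬-l {Γ} {Δ} {x} valid))
  searchLeft n x (A ⊕ B) Γ Δ _ w≤n valid =
    ⊕-l (search n ((x ∶ A) ∷ (x ∶ B) ∷ Γ) Δ (subst (ℕ._≤ n) (⊕-l-weight (size A) (size B) (weight Γ) (weight Δ)) w≤n)
                (invert-⊕-l {Γ} {Δ} {x} valid))
  searchLeft n x (A ⟶ B) Γ Δ _ w≤n valid =
    ⟶-l (search n ((x ∶ B) ∷ Γ) ((x ∶ A) ∷ Δ)
                (subst (ℕ._≤ n) (binary-l-weight (size A) (size B) (weight Γ) (weight Δ)) w≤n)
                (invert-⟶-l {Γ} {Δ} {x} valid))
  searchLeft n x (A ⟹ B) Γ Δ _ w≤n valid =
    ⟹-l i fresh-l fresh-r
      (search n ((x · atom i ∶ B) ∷ Γ) ((x · atom i ∶ A) ∷ Δ)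
              (subst (ℕ._≤ n) (binary-l-weight (size A) (size B) (weight Γ) (weight Δ)) w≤n)
              (invert-⟹-l {Γ} {Δ} {x} {A} {B} i fresh-l fresh-r valid))
    where
    i = atomBound (((x ∶ A ⟹ B) ∷ Γ) ++ Δ)
    fresh-l = atomBound-fresh (((x ∶ A ⟹ B) ∷ Γ) ++ Δ) ∘ ++⁺ˡ
    fresh-r = atomBound-fresh (((x ∶ A ⟹ B) ∷ Γ) ++ Δ) ∘ ++⁺ʳ ((x ∶ A ⟹ B) ∷ Γ)

  searchRight : ∀ n x A Γ Δ → ¬ IsVar A → weight Γ ℕ.+ weight ((x ∶ A) ∷ Δ) ℕ.≤ n →
                Valid Γ ((x ∶ A) ∷ Δ) → Γ ⊢ (x ∶ A) ∷ Δ
  searchRight n x (var _) Γ Δ compound = contradiction _ compound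
  searchRight n x t Γ Δ _ w≤n valid =
    t-r (search n Γ Δ (subst (ℕ._≤ n) (ℕₚ.+-suc (weight Γ) (weight Δ)) w≤n)
                (invert-t-r {Γ} {Δ} {x} valid))
  searchRight n x (¬' A) Γ Δ _ w≤n valid =
    ¬-r (search n ((x ∶ A) ∷ Γ) Δ (subst (ℕ._≤ n) (¬-r-weight (size A) (weight Γ) (weight Δ)) w≤n)
                (invert-¬-r {Γ} {Δ} {x} valid))
  searchRight n x (A ⊕ B) Γ Δ _ w≤n valid =
    ⊕-r (search n Γ ((x ∶ A) ∷ (x ∶ B) ∷ Δ) (subst (ℕ._≤ n) (⊕-r-weight (size A) (size B) (weight Γ) (weight Δ)) w≤n)
                (invert-⊕-r {Γ} {Δ} {x} valid))
  searchRight n x (A ⟶ B) Γ Δ _ w≤n valid =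
    ⟶-r (search n ((x ∶ A) ∷ Γ) ((x ∶ B) ∷ Δ)
                (subst (ℕ._≤ n) (binary-r-weight (size A) (size B) (weight Γ) (weight Δ)) w≤n)
                (invert-⟶-r {Γ} {Δ} {x} valid))
  searchRight n x (A ⟹ B) Γ Δ _ w≤n valid =
    ⟹-r (search n ((x ∶ A) ∷ Γ) ((x ∶ B) ∷ Δ)
                (subst (ℕ._≤ n) (binary-r-weight (size A) (size B) (weight Γ) (weight Δ)) w≤n)
                (invert-⟹-r₁ {Γ} {Δ} {x} valid))
        (search n Γ Δ (ℕₚ.≤-trans (ℕₚ.+-monoʳ-< (weight Γ) (s≤s (ℕₚ.m≤n+m (weight Δ) (size A ℕ.+ size B)))) w≤n)
                (invert-⟹-r₂ {Γ} {Δ} {x} {A} {B} valid))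

mainTheorem14 : (Γ Δ : List LFm) → Valid Γ Δ → Γ ⊢ Δ
mainTheorem14 Γ Δ = search (suc (weight Γ ℕ.+ weight Δ)) Γ Δ ℕₚ.≤-refl
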